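{- Let $D$ be an oriented graph (no loops, at most one arc between any two vertices) whose underlying graph is connected. Then $\chi_d(D)=2$ if and only if the underlying graph of $D$ is a complete bipartite graph $K_{m,n}$ (with $m,n\ge 1$) with partite sets $X$ and $Y$ such that $xy\in A(D)$ for all $x\in X$ and all $y\in Y$.
   Context: For a digraph $D$ and $v\in V(D)$, $N^+(v)=\{u: vu\in A(D)\}$. A dominator coloring of $D$ is a partition of $V(D)$ into color classes such that (i) it is a proper coloring of the underlying graph (adjacent vertices receive different colors), and (ii) every vertex $v$ with at least one out-neighbor dominates some color class, i.e., there is a color class $C$ with $C\subseteq N^+(v)$; vertices of out-degree $0$ are not required to dominate anything. $\chi_d(D)$ is the minimum number of color classes in a dominator coloring of $D$ (for this specific digraph $D$). -}

module Defs where

open import Data.Nat using (ℕ; _<_)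
open import Data.Fin using (Fin)
open import Data.Bool using (Bool; true; false)
open import Data.Product using (Σ; ∃; _×_; _,_)
open import Data.Sum using (_⊎_)
open import Data.Empty using (⊥)
open import Relation.Nullary using (¬_)
open import Relation.Binary.PropositionalEquality using (_≡_; _≢_)
open import Function.Definitions using (Surjective)
open import Function.Bundles using (_⇔_)
open import Level using (0ℓ)

record Digraph : Set₁ where
  field
    n   : ℕ
    Arc : Fin n → Fin n → Set

open Digraph public

-- Oriented graph: no loops, and at most one arc between two vertices
-- (no pair of opposite arcs; multiple parallel arcs are impossible since
-- arcs are given by a relation).
IsOriented : Digraph → Set
IsOriented D = (∀ v → ¬ Arc D v v) × (∀ u v → Arc D u v → ¬ Arc D v u)

Adj : (D : Digraph) → Fin (n D) → Fin (n D) → Set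
Adj D u v = Arc D u v ⊎ Arc D v u

data Reach (D : Digraph) : Fin (n D) → Fin (n D) → Set where
  here : ∀ {u} → Reach D u u
  step : ∀ {u v w} → Adj D u v → Reach D v w → Reach D u w

Connected : Digraph → Set
Connected D = Fin (n D) × (∀ u v → Reach D u v)

-- A partition of V(D) into exactly k (nonempty) color classes:
-- a surjective map c : V(D) → Fin k; class i is c⁻¹(i).
IsDominatorColoring : (D : Digraph) (k : ℕ) → (Fin (n D) → Fin k) → Set
IsDominatorColoring D k c =
  Surjective _≡_ _≡_ c
  × (∀ u v → Adj D u v → c u ≢ c v)
  × (∀ v → ∃ (λ w → Arc D v w) →
       ∃ (λ (i : Fin k) → ∀ u → c u ≡ i → Arc D v u))

HasDominatorColoring : Digraph → ℕ → Set
HasDominatorColoring D k = ∃ (λ (c : Fin (n D) → Fin k) → IsDominatorColoring D k c)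

ChiD≡ : Digraph → ℕ → Set
ChiD≡ D k = HasDominatorColoring D k × (∀ j → j < k → ¬ HasDominatorColoring D j)

-- Underlying graph is complete bipartite K_{m,n} (m,n ≥ 1) with partite sets
-- X = side⁻¹(true), Y = side⁻¹(false), and xy ∈ A(D) for all x ∈ X, y ∈ Y.
CompleteBipartiteOutward : Digraph → Set
CompleteBipartiteOutward D =
  Σ (Fin (n D) → Bool) λ side →
    (∃ λ x → side x ≡ true) × (∃ λ y → side y ≡ false)
    × (∀ u v → (Adj D u v ⇔ (side u ≢ side v)))
    × (∀ x y → side x ≡ true → side y ≡ false → Arc D x y)

-- Suppose D has a dominator colouring with two classes. Some vertex s has an out-neighbour, so
-- s dominates a class J, and J is not its own class I since D has no loops. A vertex of J with an
-- out-neighbour would have to dominate I and so point back at s, which already points at it; hence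
-- J is a class of sinks. By connectivity every vertex of I has a neighbour, necessarily in J and
-- not pointing at it, so it has an out-neighbour and therefore dominates J. Thus all arcs go from
-- I to J and every such arc is present. Conversely, colouring the two sides of an outward complete
-- bipartite orientation is a dominator colouring, and no fewer colours suffice since there is an
-- edge.
module Submission where

open import Defs
open import Data.Bool using (Bool; true; false)
open import Data.Fin using (Fin; zero; suc; _≟_)
open import Data.Fin.Properties using (¬Fin0; 1↔⊤; 2↔Bool)
open import Data.Nat using (ℕ; zero; suc; _<_; s≤s)
open import Data.Product using (∃; ∃₂; _,_; proj₁; proj₂)
open import Data.Sum using (inj₁; inj₂)
open import Function.Bundles using (_⇔_; mk⇔; Equivalence; Inverse; Injection)
open import Function.Properties.Inverse using (↔⇒↣; ↔-sym)
open import Function.Definitions using (Surjective)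
open import Relation.Nullary using (¬_; does; contradiction)
open import Relation.Nullary.Decidable using (dec-true; dec-false)
open import Relation.Binary.PropositionalEquality using (_≡_; _≢_; refl; sym; trans; cong)

Dominates : (D : Digraph) {k : ℕ} → (Fin (n D) → Fin k) → Fin (n D) → Fin k → Set
Dominates D c v i = ∀ u → c u ≡ i → Arc D v u

fin2-≢-≢⇒≡ : {a b x : Fin 2} → a ≢ b → x ≢ a → x ≡ b
fin2-≢-≢⇒≡ {zero}     {zero}     a≢b _   = contradiction refl a≢b
fin2-≢-≢⇒≡ {suc zero} {suc zero} a≢b _   = contradiction refl a≢b
fin2-≢-≢⇒≡ {zero}     {suc zero} {zero}     _ x≢a = contradiction refl x≢a
fin2-≢-≢⇒≡ {zero}     {suc zero} {suc zero} _ _   = refl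
fin2-≢-≢⇒≡ {suc zero} {zero}     {zero}     _ _   = refl
fin2-≢-≢⇒≡ {suc zero} {zero}     {suc zero} _ x≢a = contradiction refl x≢a

does-≟-injective : (i x y : Fin 2) → does (x ≟ i) ≡ does (y ≟ i) → x ≡ y
does-≟-injective zero       zero       zero       _ = refl
does-≟-injective zero       (suc zero) (suc zero) _ = refl
does-≟-injective (suc zero) zero       zero       _ = refl
does-≟-injective (suc zero) (suc zero) (suc zero) _ = refl
does-≟-injective zero       zero       (suc zero) ()
does-≟-injective zero       (suc zero) zero       ()
does-≟-injective (suc zero) zero       (suc zero) ()
does-≟-injective (suc zero) (suc zero) zero       ()

module _ {D : Digraph} where

  connected⇒neighbour : Connected D → {a b : Fin (n D)} → a ≢ b → ∃ (Adj D a)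
  connected⇒neighbour (_ , reach) {a} {b} a≢b with reach a b
  ... | here              = contradiction refl a≢b
  ... | step {v = v} a∼v _ = v , a∼v

  dominates⇒≢ : {k : ℕ} {c : Fin (n D) → Fin k} {v : Fin (n D)} {i : Fin k} →
                (∀ v → ¬ Arc D v v) → Dominates D c v i → c v ≢ i
  dominates⇒≢ loopless v↠i refl = loopless _ (v↠i _ refl)

  outward⇒adj : (side : Fin (n D) → Bool) →
                (∀ x y → side x ≡ true → side y ≡ false → Arc D x y) →
                ∀ a b → side a ≢ side b → Adj D a b
  outward⇒adj side arcs a b sa≢sb with side a in sa | side b in sb
  ... | true  | true  = contradiction refl sa≢sb
  ... | true  | false = inj₁ (arcs a b sa sb)
  ... | false | true  = inj₂ (arcs b a sb sa)
  ... | false | false = contradiction refl sa≢sb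

  vertex⇒¬0-colouring : Fin (n D) → ¬ HasDominatorColoring D 0
  vertex⇒¬0-colouring v (c , _) = ¬Fin0 (c v)

  adj⇒¬1-colouring : {a b : Fin (n D)} → Adj D a b → ¬ HasDominatorColoring D 1
  adj⇒¬1-colouring a∼b (c , _ , proper , _) = proper _ _ a∼b (Injection.injective (↔⇒↣ 1↔⊤) refl)

module TwoClasses {D : Digraph} (oriented : IsOriented D) (connected : Connected D)
                  {c : Fin (n D) → Fin 2} (dc : IsDominatorColoring D 2 c) where

  private
    loopless : ∀ v → ¬ Arc D v v
    loopless = proj₁ oriented

    asym : ∀ u v → Arc D u v → ¬ Arc D v u
    asym = proj₂ oriented

    surj : Surjective _≡_ _≡_ c
    surj = proj₁ dc

    proper : ∀ u v → Adj D u v → c u ≢ c v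
    proper = proj₁ (proj₂ dc)

    dom : ∀ v → ∃ (Arc D v) → ∃ (Dominates D c v)
    dom = proj₂ (proj₂ dc)

  vertex-of-colour : ∀ i → ∃ λ v → c v ≡ i
  vertex-of-colour i = proj₁ (surj i) , proj₂ (surj i) refl

  differently-coloured⇒≢ : ∀ {a b i j} → c a ≡ i → c b ≡ j → i ≢ j → a ≢ b
  differently-coloured⇒≢ ca≡i cb≡j i≢j refl = i≢j (trans (sym ca≡i) cb≡j)

  dominates-other-colour : ∀ v {k} → ∃ (Arc D v) → c v ≢ k → Dominates D c v k
  dominates-other-colour v {k} out cv≢k with dom v out
  ... | l , v↠l with fin2-≢-≢⇒≡ (dominates⇒≢ loopless v↠l) (λ k≡cv → cv≢k (sym k≡cv))
  ...   | refl = v↠l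

  some-arc : ∃₂ (Arc D)
  some-arc with vertex-of-colour zero | vertex-of-colour (suc zero)
  ... | a , ca≡0 | b , cb≡1 with connected⇒neighbour connected (differently-coloured⇒≢ ca≡0 cb≡1 λ ())
  ...   | v , inj₁ a→v = a , v , a→v
  ...   | v , inj₂ v→a = v , a , v→a

  private
    s : Fin (n D)
    s = proj₁ some-arc

    s→ : ∃ (Arc D s)
    s→ = proj₂ some-arc

  I J : Fin 2
  I = c s
  J = proj₁ (dom s s→)

  s↠J : Dominates D c s J
  s↠J = proj₂ (dom s s→)

  I≢J : I ≢ J
  I≢J = dominates⇒≢ {D = D} loopless s↠J

  J-sink : ∀ v → c v ≡ J → ¬ ∃ (Arc D v)
  J-sink v cv≡J out = asym s v (s↠J v cv≡J)
    (dominates-other-colour v out (λ cv≡I → I≢J (trans (sym cv≡I) cv≡J)) s refl)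

  I-dominates-J : ∀ a → c a ≡ I → Dominates D c a J
  I-dominates-J a ca≡I
    with b , cb≡J ← vertex-of-colour J
    with connected⇒neighbour connected (differently-coloured⇒≢ ca≡I cb≡J I≢J)
  ... | v , inj₁ a→v = dominates-other-colour a (v , a→v) (λ ca≡J → I≢J (trans (sym ca≡I) ca≡J))
  ... | v , inj₂ v→a = contradiction (a , v→a) (J-sink v cv≡J)
    where cv≡J : c v ≡ J
          cv≡J = fin2-≢-≢⇒≡ I≢J (λ cv≡I → proper v a (inj₁ v→a) (trans cv≡I (sym ca≡I)))

  side : Fin (n D) → Bool
  side v = does (c v ≟ I)

  true-side : ∀ {a} → side a ≡ true → c a ≡ I
  true-side {a} sa = does-≟-injective I (c a) I (trans sa (sym (dec-true (I ≟ I) refl)))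

  false-side : ∀ {a} → side a ≡ false → c a ≡ J
  false-side {a} sa = fin2-≢-≢⇒≡ I≢J (λ ca≡I → contradiction (trans (sym (dec-true (c a ≟ I) ca≡I)) sa) λ ())

  completeBipartiteOutward : CompleteBipartiteOutward D
  completeBipartiteOutward =
    side , (s , dec-true (I ≟ I) refl) , (b , dec-false (c b ≟ I) (λ cb≡I → I≢J (trans (sym cb≡I) cb≡J)))
    , (λ u v → mk⇔ (λ u∼v su≡sv → proper u v u∼v (does-≟-injective I (c u) (c v) su≡sv))
                   (outward⇒adj side outward u v))
    , outward
    where
    b : Fin (n D)
    b = proj₁ (vertex-of-colour J)

    cb≡J : c b ≡ J
    cb≡J = proj₂ (vertex-of-colour J)

    outward : ∀ x y → side x ≡ true → side y ≡ false → Arc D x y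
    outward x y sx sy = I-dominates-J x (true-side sx) y (false-side sy)

completeBipartiteOutward⇒χd≡2 : {D : Digraph} → IsOriented D → CompleteBipartiteOutward D → ChiD≡ D 2
completeBipartiteOutward⇒χd≡2 {D} (_ , asym) (side , (x , sx) , (y , sy) , adj⇔ , arcs) =
  (colour , surjective , proper , dominating) , fewer
  where
  open Inverse 2↔Bool using (from)

  from-injective : ∀ {p q} → from p ≡ from q → p ≡ q
  from-injective = Injection.injective (↔⇒↣ (↔-sym 2↔Bool))

  -- 2↔Bool sends false to 0F and true to 1F, so the sinks get colour 0F.
  colour : Fin (n D) → Fin 2
  colour v = from (side v)

  surjective : Surjective _≡_ _≡_ colour
  surjective zero       = y , λ { refl → cong from sy }
  surjective (suc zero) = x , λ { refl → cong from sx }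

  proper : ∀ a b → Adj D a b → colour a ≢ colour b
  proper a b a∼b e = Equivalence.to (adj⇔ a b) a∼b (from-injective e)

  source-side : ∀ {v w} → Arc D v w → side v ≡ true
  source-side {v} {w} v→w with side v in sv | side w in sw
  ... | true  | _     = refl
  ... | false | true  = contradiction (arcs w v sw sv) (asym v w v→w)
  ... | false | false = contradiction (trans sv (sym sw)) (Equivalence.to (adj⇔ v w) (inj₁ v→w))

  dominating : ∀ v → ∃ (Arc D v) → ∃ λ i → Dominates D colour v i
  dominating v (_ , v→w) = zero , λ u cu≡0 → arcs v u (source-side v→w) (from-injective cu≡0)

  fewer : ∀ k → k < 2 → ¬ HasDominatorColoring D k
  fewer zero          _                = vertex⇒¬0-colouring x
  fewer (suc zero)    _                = adj⇒¬1-colouring x∼y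
    where x∼y : Adj D x y
          x∼y = Equivalence.from (adj⇔ x y) (λ sx≡sy → contradiction (trans (sym sx) (trans sx≡sy sy)) λ ())
  fewer (suc (suc _)) (s≤s (s≤s ()))

theorem3 : (D : Digraph) → IsOriented D → Connected D →
    (ChiD≡ D 2 ⇔ CompleteBipartiteOutward D)
theorem3 D oriented connected =
  mk⇔ (λ ((_ , dc) , _) → TwoClasses.completeBipartiteOutward oriented connected dc)
      (completeBipartiteOutward⇒χd≡2 oriented)
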